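{- Let $D=(D_1,\dots,D_L)$ be a sequence of real numbers and let $1\le i\le j\le L$. If $a\in B(i)$ and $a\ge j$, then $a\in B(j)$.
   Context: For a sequence $F$ of reals and $1\le s\le t\le |F|$ write $\bar F(s,t)$ for the average of $F_s,\dots,F_t$. An index $1\le k\le |F|$ is a border of $F$ if there is a (possibly empty) sequence $E$ such that, with $G$ the concatenation of $F$ and $E$, $\bar G(k,|G|)=\max_{1\le s\le |G|}\bar G(s,|G|)$. For $1\le i\le L$, $B(i)$ denotes the set of indices $b$ with $i\le b\le L$ such that $b-i+1$ is a border of the sequence $(D_i,\dots,D_L)$. -}

module Defs where

open import Level using (Level; suc; _⊔_)
open import Data.Nat as ℕ using (ℕ; zero)
open import Data.List using (List; []; _∷_; length; drop; _++_)
import Data.Sum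
open import Data.Product using (Σ; ∃; _×_)
open import Relation.Binary.PropositionalEquality using (_≡_; _≢_)

-- The real numbers, axiomatised as a complete ordered field
-- (any model of this record is isomorphic to ℝ).
record CompleteOrderedField (c ℓ : Level) : Set (suc (c ⊔ ℓ)) where
  infixl 6 _+_
  infixl 7 _*_
  infix  4 _≤_
  field
    Carrier : Set c
    _+_ _*_ : Carrier → Carrier → Carrier
    -_      : Carrier → Carrier
    _⁻¹     : Carrier → Carrier
    0# 1#   : Carrier
    _≤_     : Carrier → Carrier → Set ℓ
    +-assoc : ∀ x y z → (x + y) + z ≡ x + (y + z)
    +-comm  : ∀ x y → x + y ≡ y + x
    +-identityˡ : ∀ x → 0# + x ≡ x
    -‿inverseˡ : ∀ x → (- x) + x ≡ 0#
    *-assoc : ∀ x y z → (x * y) * z ≡ x * (y * z)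
    *-comm  : ∀ x y → x * y ≡ y * x
    *-identityˡ : ∀ x → 1# * x ≡ x
    distribˡ : ∀ x y z → x * (y + z) ≡ (x * y) + (x * z)
    0≢1 : 0# ≢ 1#
    ⁻¹-inverse : ∀ x → x ≢ 0# → x * (x ⁻¹) ≡ 1#
    ≤-refl  : ∀ {x} → x ≤ x
    ≤-trans : ∀ {x y z} → x ≤ y → y ≤ z → x ≤ z
    ≤-antisym : ∀ {x y} → x ≤ y → y ≤ x → x ≡ y
    ≤-total : ∀ x y → (x ≤ y) Data.Sum.⊎ (y ≤ x)
    +-mono-≤ : ∀ {x y} z → x ≤ y → x + z ≤ y + z
    *-nonneg : ∀ {x y} → 0# ≤ x → 0# ≤ y → 0# ≤ x * y
    sup : ∀ (P : Carrier → Set c) → ∃ P →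
          Σ Carrier (λ u → ∀ x → P x → x ≤ u) →
          Σ Carrier (λ s → (∀ x → P x → x ≤ s) ×
                           (∀ u → (∀ x → P x → x ≤ u) → s ≤ u))

  fromℕ : ℕ → Carrier
  fromℕ zero = 0#
  fromℕ (ℕ.suc n) = 1# + fromℕ n

  sum : List Carrier → Carrier
  sum [] = 0#
  sum (x ∷ xs) = x + sum xs

  -- suffAvg G s = Ḡ(s,|G|) = average of G_s,…,G_|G| (1-indexed; used with 1 ≤ s ≤ |G|)
  suffAvg : List Carrier → ℕ → Carrier
  suffAvg G s = sum (drop (s ℕ.∸ 1) G) * (fromℕ (length G ℕ.∸ s ℕ.+ 1)) ⁻¹

  IsBorder : List Carrier → ℕ → Set (c ⊔ ℓ)
  IsBorder F k = 1 ℕ.≤ k × k ℕ.≤ length F ×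
    ∃ λ (E : List Carrier) →
      ∀ s → 1 ℕ.≤ s → s ℕ.≤ length (F ++ E) →
        suffAvg (F ++ E) s ≤ suffAvg (F ++ E) k

  InB : List Carrier → ℕ → ℕ → Set (c ⊔ ℓ)
  InB D i b = i ℕ.≤ b × b ℕ.≤ length D ×
    IsBorder (drop (i ℕ.∸ 1) D) (b ℕ.∸ i ℕ.+ 1)

module Submission where

-- Write i ≤ j ≤ a and put d = j − i.  The sequence
-- (D_j,…,D_L) is the sequence (D_i,…,D_L) with its first d entries
-- removed, and a − j + 1 is the index a − i + 1 shifted down by d.
-- Dropping the first d entries of a sequence G only re-indexes its
-- suffix averages:  the suffix of drop d G starting at s is the suffix
-- of G starting at d + s.  Hence if a − i + 1 is a border of
-- (D_i,…,D_L) with extension E, the same E witnesses that a − j + 1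
-- is a border of (D_j,…,D_L): every suffix average of the shorter
-- extended sequence is a suffix average of the longer one, and the
-- maximal one is still attained at the shifted index.

open import Defs
open import Data.Nat using (ℕ; _≤_; _+_; _∸_; zero; suc; s≤s)
open import Data.Nat.Properties
open import Data.List using (List; length; drop; _++_; _∷_)
open import Data.List.Properties using (drop-drop; length-drop; length-++-≤ˡ)
open import Data.Product using (_,_)
open import Relation.Binary.PropositionalEquality

drop-++ : ∀ {a} {A : Set a} d (xs ys : List A) → d ≤ length xs →
          drop d (xs ++ ys) ≡ drop d xs ++ ys
drop-++ zero    xs       ys _         = refl
drop-++ (suc d) (x ∷ xs) ys (s≤s d≤n) = drop-++ d xs ys d≤n

∸-split : ∀ {m n o} → n ≤ o → o ≤ m → m ∸ n ≡ (o ∸ n) + (m ∸ o)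
∸-split {m} {n} {o} n≤o o≤m = begin
  m ∸ n                ≡⟨ cong (_∸ n) (sym (m+[n∸m]≡n o≤m)) ⟩
  (o + (m ∸ o)) ∸ n    ≡⟨ +-∸-comm (m ∸ o) n≤o ⟩
  (o ∸ n) + (m ∸ o)    ∎
  where open ≡-Reasoning

module _ {c ℓ} (R : CompleteOrderedField c ℓ) where
  open CompleteOrderedField R
    using (Carrier; sum; fromℕ; _*_; _⁻¹; suffAvg; IsBorder)
    renaming (_≤_ to _≤ᴿ_)

  MaxAt : List Carrier → ℕ → Set ℓ
  MaxAt G k = ∀ s → 1 ≤ s → s ≤ length G → suffAvg G s ≤ᴿ suffAvg G k

  suffAvg-drop : ∀ (G : List Carrier) d s → 1 ≤ s →
                 suffAvg (drop d G) s ≡ suffAvg G (d + s)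
  suffAvg-drop G d s 1≤s =
    cong₂ (λ xs n → sum xs * (fromℕ (n + 1)) ⁻¹) sameSuffix sameLength
    where
    sameSuffix : drop (s ∸ 1) (drop d G) ≡ drop (d + s ∸ 1) G
    sameSuffix = trans (drop-drop d (s ∸ 1) G)
                       (cong (λ t → drop t G) (sym (+-∸-assoc d 1≤s)))
    sameLength : length (drop d G) ∸ s ≡ length G ∸ (d + s)
    sameLength = trans (cong (_∸ s) (length-drop d G)) (∸-+-assoc (length G) d s)

  maxAt-drop : ∀ (G : List Carrier) d k → d ≤ length G → 1 ≤ k →
               MaxAt G (d + k) → MaxAt (drop d G) k
  maxAt-drop G d k d≤G 1≤k maxG s 1≤s s≤ =
    subst₂ _≤ᴿ_ (sym (suffAvg-drop G d s 1≤s)) (sym (suffAvg-drop G d k 1≤k))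
      (maxG (d + s) (≤-trans 1≤s (m≤n+m s d)) shiftedInRange)
    where
    shiftedInRange : d + s ≤ length G
    shiftedInRange = begin
      d + s                   ≤⟨ +-monoʳ-≤ d (≤-trans s≤ (≤-reflexive (length-drop d G))) ⟩
      d + (length G ∸ d)      ≡⟨ m+[n∸m]≡n d≤G ⟩
      length G                ∎
      where open ≤-Reasoning

  border-drop : ∀ (F : List Carrier) d k → 1 ≤ k →
                IsBorder F (d + k) → IsBorder (drop d F) k
  border-drop F d k 1≤k (_ , d+k≤F , E , maxFE) =
    1≤k , k≤rest , E ,
    subst (λ G → MaxAt G k) (drop-++ d F E d≤F)
      (maxAt-drop (F ++ E) d k (≤-trans d≤F (length-++-≤ˡ F)) 1≤k maxFE)
    where
    d≤F : d ≤ length F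
    d≤F = m+n≤o⇒m≤o d d+k≤F
    k≤rest : k ≤ length (drop d F)
    k≤rest = ≤-trans (m+n≤o⇒m≤o∸n k (≤-trans (≤-reflexive (+-comm k d)) d+k≤F))
                     (≤-reflexive (sym (length-drop d F)))

theorem7 : ∀ {c ℓ} (R : CompleteOrderedField c ℓ) →
    (D : List (CompleteOrderedField.Carrier R)) (i j a : ℕ) →
    1 ≤ i → i ≤ j → j ≤ length D →
    CompleteOrderedField.InB R D i a → j ≤ a →
    CompleteOrderedField.InB R D j a
theorem7 R D i j a 1≤i i≤j _ (_ , a≤L , borderᵢ) j≤a =
  j≤a , a≤L ,
  subst (λ F → IsBorder F (a ∸ j + 1)) sameSuffix
    (border-drop R (drop (i ∸ 1) D) (j ∸ i) (a ∸ j + 1) (m≤n+m 1 (a ∸ j))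
      (subst (IsBorder (drop (i ∸ 1) D)) sameIndex borderᵢ))
  where
  open CompleteOrderedField R using (IsBorder)
  sameIndex : a ∸ i + 1 ≡ (j ∸ i) + (a ∸ j + 1)
  sameIndex = trans (cong (_+ 1) (∸-split i≤j j≤a)) (+-assoc (j ∸ i) (a ∸ j) 1)
  sameSuffix : drop (j ∸ i) (drop (i ∸ 1) D) ≡ drop (j ∸ 1) D
  sameSuffix = trans (drop-drop (i ∸ 1) (j ∸ i) D)
                     (cong (λ t → drop t D) (sym (∸-split 1≤i i≤j)))
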